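{- Let $N$ be a positive integer. A nonempty set $S=\{x_1>x_2>\cdots>x_\ell\}$ of positive integers is of the form $P_\alpha$ for some $\alpha\in\mathrm{OC}_{\le N}$ if and only if $x_i+x_{\ell+1-i}\ge N+1$ and $x_{i+1}+x_{\ell+1-i}<N+1$ for all $1\le i\le\ell$, where $x_{\ell+1}:=0$.
   Context: An odd composition is a finite sequence of odd positive integers; $\mathrm{OC}_{\le N}$ is the set of odd compositions of integers in $\{0,\ldots,N\}$. $\sigma_N$ is the permutation of $\{1,\ldots,N\}$ with $\sigma_N(i)=i/2$ for $i$ even and $\sigma_N(i)=N+(1-i)/2$ for $i$ odd. For $\alpha=(\alpha_1,\ldots,\alpha_\ell)\in\mathrm{OC}_{\le N}$, $P_\alpha=\{\sigma_N(\alpha_1+\cdots+\alpha_j):1\le j\le\ell\}\subseteq\{1,\ldots,N\}$. -}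

module Defs where

open import Data.Nat using (ℕ; zero; suc; _+_; _∸_; _≤_; _<_)
open import Data.Nat.DivMod using (_/_; _%_)
open import Data.List using (List; []; _∷_; map; length)
open import Data.Nat.ListAction using (sum)
open import Data.List.Relation.Unary.All using (All)
open import Data.Product using (_×_)
open import Relation.Binary.PropositionalEquality using (_≡_)

Odd : ℕ → Set
Odd n = n % 2 ≡ 1

-- α ∈ OC_{≤N}: a finite sequence of odd positive integers with sum ≤ N
-- (odd numbers are automatically positive)
IsOC≤ : ℕ → List ℕ → Set
IsOC≤ N α = All Odd α × sum α ≤ N

σ : ℕ → ℕ → ℕ
σ N i with i % 2
... | 0 = i / 2
... | _ = N ∸ ((i ∸ 1) / 2)

partialSums : List ℕ → List ℕ
partialSums [] = []
partialSums (a ∷ as) = a ∷ map (a +_) (partialSums as)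

-- P_α (as a list; read as a set via membership)
P : ℕ → List ℕ → List ℕ
P N α = map (σ N) (partialSums α)

-- 1-based indexing x_i of a list, with value 0 out of range (so x_{ℓ+1} = 0)
at : List ℕ → ℕ → ℕ
at [] _ = 0
at (x ∷ xs) zero = 0
at (x ∷ xs) (suc zero) = x
at (x ∷ xs) (suc (suc i)) = at xs (suc i)

Cond : ℕ → List ℕ → Set
Cond N xs = ∀ i → 1 ≤ i → i ≤ length xs →
  (suc N ≤ at xs i + at xs (suc (length xs) ∸ i))
  × (at xs (suc i) + at xs (suc (length xs) ∸ i) < suc N)

{-# OPTIONS --safe #-}
-- Write α = (2k+1) ∷ β. Then β ∈ OC≤M with N = 2k+1+M, and σ_N sends the partial sums of α to
-- K = k+M+1 followed by K − P_M β; note K + K = N + 1 + M. Dually, a decreasing list K ∷ rest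
-- satisfies the condition for N iff its reflection K − x_ℓ > ⋯ > K − x₂ satisfies it for M:
-- for a, b ≤ K we have a + b ≤ N iff (K − a) + (K − b) > M, so the reflection exchanges the two
-- families of inequalities. Both directions then follow by induction, peeling one part of α
-- (resp. the largest element of the set) at a time.
module Submission where

open import Defs
open import Data.Nat using (ℕ; zero; suc; _+_; _*_; _∸_; _≤_; _<_; _>_; z≤n; s≤s)
open import Data.Nat.Properties
open import Data.Nat.DivMod using (m*n%n≡0; [m+kn]%n≡m%n; m*n/n≡m)
open import Data.Nat.ListAction using (sum)
open import Data.Nat.Tactic.RingSolver using (solve-∀)
open import Data.List using (List; []; _∷_; map; length; reverse; _∷ʳ_)
open import Data.List.Properties
  using (map-∘; map-cong-local; map-++; unfold-reverse; length-reverse; length-map)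
open import Data.List.Relation.Unary.All as All using (All; []; _∷_)
import Data.List.Relation.Unary.All.Properties as All
open import Data.List.Relation.Unary.AllPairs using (AllPairs; []; _∷_)
import Data.List.Relation.Unary.AllPairs.Properties as AllPairs
open import Data.List.Relation.Unary.Any using (here; there)
import Data.List.Relation.Unary.Any.Properties as Any
open import Data.List.Relation.Unary.Linked using (Linked)
open import Data.List.Relation.Unary.Linked.Properties using (Linked⇒AllPairs)
open import Data.List.Membership.Propositional using (_∈_)
open import Data.List.Membership.Propositional.Properties using (∈-map⁺; ∈-map⁻)
open import Data.Product using (_×_; _,_; proj₁; proj₂; ∃; ∃₂; map₂)
open import Data.Sum using (inj₁; inj₂)
open import Function using (_∘_; id)
open import Function.Bundles using (_⇔_; mk⇔; Equivalence)
open import Relation.Nullary using (contradiction)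
open import Relation.Binary.PropositionalEquality
open ≡-Reasoning

data EvenOrOdd : ℕ → Set where
  even : ∀ j → EvenOrOdd (j * 2)
  odd  : ∀ j → EvenOrOdd (suc (j * 2))

evenOrOdd : ∀ n → EvenOrOdd n
evenOrOdd zero = even 0
evenOrOdd (suc n) with evenOrOdd n
... | even j = odd j
... | odd j  = even (suc j)

Odd⇒∃[k]≡1+k*2 : ∀ {a} → Odd a → ∃ λ k → a ≡ suc (k * 2)
Odd⇒∃[k]≡1+k*2 {a} odd-a with evenOrOdd a
... | odd k  = k , refl
... | even j = contradiction (trans (sym (m*n%n≡0 j 2)) odd-a) λ ()

Odd[1+k*2] : ∀ k → Odd (suc (k * 2))
Odd[1+k*2] k = [m+kn]%n≡m%n 1 k 2

σ-even : ∀ N j → σ N (j * 2) ≡ j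
σ-even N j rewrite m*n%n≡0 j 2 {{_}} = m*n/n≡m j 2

σ-odd : ∀ N j → σ N (suc (j * 2)) ≡ N ∸ j
σ-odd N j rewrite [m+kn]%n≡m%n 1 j 2 {{_}} = cong (N ∸_) (m*n/n≡m j 2)

partialSums-≤ : ∀ β → All (_≤ sum β) (partialSums β)
partialSums-≤ []      = []
partialSums-≤ (b ∷ β) = m≤m+n b (sum β) ∷ All.map⁺ (All.map (+-monoʳ-≤ b) (partialSums-≤ β))

m+n≡1+o+p⇒m≤o⇔p<n : ∀ {m n o p} → m + n ≡ suc o + p → (m ≤ o ⇔ p < n)
m+n≡1+o+p⇒m≤o⇔p<n eq = mk⇔
  (λ m≤o → ≰⇒> (λ n≤p → <-irrefl eq (s≤s (+-mono-≤ m≤o n≤p))))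
  (λ p<n → ≮⇒≥ (λ o<m → <-irrefl (sym eq) (+-mono-≤-< o<m p<n)))

m+n+[o∸n+o∸m]≡o+o : ∀ {m n o} → m ≤ o → n ≤ o → (m + n) + ((o ∸ n) + (o ∸ m)) ≡ o + o
m+n+[o∸n+o∸m]≡o+o {m} {n} {o} m≤o n≤o = begin
  (m + n) + ((o ∸ n) + (o ∸ m)) ≡⟨ interchange m n (o ∸ n) (o ∸ m) ⟩
  (m + (o ∸ m)) + (n + (o ∸ n)) ≡⟨ cong₂ _+_ (m+[n∸m]≡n m≤o) (m+[n∸m]≡n n≤o) ⟩
  o + o                         ∎
  where
  interchange : ∀ a b c d → (a + b) + (c + d) ≡ (a + d) + (b + c)
  interchange = solve-∀

Condᶠ : ℕ → ℕ → (ℕ → ℕ) → Set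
Condᶠ N ℓ f = ∀ i → 1 ≤ i → i ≤ ℓ →
  (suc N ≤ f i + f (suc ℓ ∸ i)) × (f (suc i) + f (suc ℓ ∸ i) < suc N)

Condᶠ-cong : ∀ {N ℓ f g} → (∀ i → 1 ≤ i → i ≤ suc ℓ → f i ≡ g i) →
             Condᶠ N ℓ f → Condᶠ N ℓ g
Condᶠ-cong {N} {ℓ} {f} {g} f≡g C i 1≤i i≤ℓ =
  subst₂ (λ u v → suc N ≤ u + v) (f≡g i 1≤i (m≤n⇒m≤1+n i≤ℓ)) mirror (proj₁ (C i 1≤i i≤ℓ)) ,
  subst₂ (λ u v → u + v < suc N) (f≡g (suc i) (s≤s z≤n) (s≤s i≤ℓ)) mirror (proj₂ (C i 1≤i i≤ℓ))
  where
  mirror : f (suc ℓ ∸ i) ≡ g (suc ℓ ∸ i)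
  mirror = f≡g (suc ℓ ∸ i) (m<n⇒0<n∸m (s≤s i≤ℓ)) (m∸n≤m (suc ℓ) i)

module Step (k M : ℕ) where
  N : ℕ
  N = suc (k * 2 + M)

  K : ℕ
  K = suc (k + M)

  K≤N : K ≤ N
  K≤N = s≤s (+-monoˡ-≤ M (m≤m*n k 2))

  M<K : M < K
  M<K = s≤s (m≤n+m M k)

  K+K≡1+N+M : K + K ≡ suc N + M
  K+K≡1+N+M = identity k M
    where
    identity : ∀ k M → suc (k + M) + suc (k + M) ≡ suc (suc (k * 2 + M)) + M
    identity = solve-∀

  K+K≡1+M+N : K + K ≡ suc M + N
  K+K≡1+M+N = trans K+K≡1+N+M (cong suc (+-comm N M))

  N∸k≡K : N ∸ k ≡ K
  N∸k≡K = trans (cong (_∸ k) (identity k M)) (m+n∸m≡n k K)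
    where
    identity : ∀ k M → suc (k * 2 + M) ≡ k + suc (k + M)
    identity = solve-∀

  IsOC≤-∷ : ∀ {β} → IsOC≤ M β → IsOC≤ N (suc (k * 2) ∷ β)
  IsOC≤-∷ (odds , Σβ≤M) = Odd[1+k*2] k ∷ odds , s≤s (+-monoʳ-≤ (k * 2) Σβ≤M)

  σ-head : σ N (suc (k * 2)) ≡ K
  σ-head = trans (σ-odd N k) N∸k≡K

  σ-shift : ∀ {s} → s ≤ M → σ N (suc (k * 2) + s) ≡ K ∸ σ M s
  σ-shift {s} s≤M with evenOrOdd s
  ... | even j = begin
    σ N (suc (k * 2) + j * 2) ≡⟨ cong (σ N) (identity k j) ⟩
    σ N (suc ((k + j) * 2))   ≡⟨ σ-odd N (k + j) ⟩
    N ∸ (k + j)               ≡⟨ ∸-+-assoc N k j ⟨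
    N ∸ k ∸ j                 ≡⟨ cong (_∸ j) N∸k≡K ⟩
    K ∸ j                     ≡⟨ cong (K ∸_) (σ-even M j) ⟨
    K ∸ σ M (j * 2)           ∎
    where
    identity : ∀ k j → suc (k * 2) + j * 2 ≡ suc ((k + j) * 2)
    identity = solve-∀
  ... | odd j = begin
    σ N (suc (k * 2) + suc (j * 2)) ≡⟨ cong (σ N) (identity k j) ⟩
    σ N (suc (k + j) * 2)           ≡⟨ σ-even N (suc (k + j)) ⟩
    suc (k + j)                     ≡⟨ cong (suc k +_) (m∸[m∸n]≡n j≤M) ⟨
    suc k + (M ∸ (M ∸ j))           ≡⟨ +-∸-assoc (suc k) (m∸n≤m M j) ⟨
    K ∸ (M ∸ j)                     ≡⟨ cong (K ∸_) (σ-odd M j) ⟨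
    K ∸ σ M (suc (j * 2))           ∎
    where
    identity : ∀ k j → suc (k * 2) + suc (j * 2) ≡ suc (k + j) * 2
    identity = solve-∀
    j≤M : j ≤ M
    j≤M = ≤-trans (m≤m*n j 2) (≤-trans (n≤1+n (j * 2)) s≤M)

  P-∷ : ∀ β → sum β ≤ M → P N (suc (k * 2) ∷ β) ≡ K ∷ map (K ∸_) (P M β)
  P-∷ β Σβ≤M = cong₂ _∷_ σ-head (begin
    map (σ N) (map (suc (k * 2) +_) (partialSums β)) ≡⟨ map-∘ (partialSums β) ⟨
    map (σ N ∘ (suc (k * 2) +_)) (partialSums β)     ≡⟨ map-cong-local shifted ⟩
    map ((K ∸_) ∘ σ M) (partialSums β)               ≡⟨ map-∘ (partialSums β) ⟩
    map (K ∸_) (P M β)                               ∎)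
    where
    shifted : All (λ s → σ N (suc (k * 2) + s) ≡ K ∸ σ M s) (partialSums β)
    shifted = All.map (λ s≤Σβ → σ-shift (≤-trans s≤Σβ Σβ≤M)) (partialSums-≤ β)

  P-∷-bounds : ∀ {β} → IsOC≤ M β → All (λ p → 0 < p × p ≤ M) (P M β) →
               All (λ p → 0 < p × p ≤ N) (P N (suc (k * 2) ∷ β))
  P-∷-bounds {β} (_ , Σβ≤M) bounds rewrite P-∷ β Σβ≤M =
    (s≤s z≤n , K≤N) ∷ All.map⁺ (All.map reflected bounds)
    where
    reflected : ∀ {p} → 0 < p × p ≤ M → 0 < K ∸ p × K ∸ p ≤ N
    reflected {p} (_ , p≤M) = m<n⇒0<n∸m (≤-<-trans p≤M M<K) , ≤-trans (m∸n≤m K p) K≤N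

  -- For f = at (K ∷ rest), g agrees with at (reflect K rest) on 1 … m+1 (see at-reflect).
  module Reflection (m : ℕ) (f : ℕ → ℕ) (f-head : f 1 ≡ K) (f-end : f (suc (suc m)) ≡ 0)
                    (f≤K : ∀ i → f i ≤ K) where
    g : ℕ → ℕ
    g i = K ∸ f (suc (suc m) ∸ i)

    g-mirror : ∀ {i} → i ≤ m → g (suc m ∸ i) ≡ K ∸ f (suc i)
    g-mirror {i} i≤m = cong (λ j → K ∸ f j) (begin
      suc (suc m) ∸ (suc m ∸ i)   ≡⟨ +-∸-assoc 1 (m∸n≤m (suc m) i) ⟩
      suc (suc m ∸ (suc m ∸ i))   ≡⟨ cong suc (m∸[m∸n]≡n (m≤n⇒m≤1+n i≤m)) ⟩
      suc i                       ∎)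

    f-last : f (suc m ∸ m) ≡ K
    f-last = trans (cong f (m+n∸n≡m 1 m)) f-head

    outer⇔ : ∀ {i} → i ≤ m →
             (f (suc i) + f (suc (suc m) ∸ i) ≤ N) ⇔ (M < g i + g (suc m ∸ i))
    outer⇔ {i} i≤m = subst (λ x → (a + b ≤ N) ⇔ (M < g i + x)) (sym (g-mirror i≤m))
      (m+n≡1+o+p⇒m≤o⇔p<n (trans (m+n+[o∸n+o∸m]≡o+o (f≤K (suc i)) (f≤K _)) K+K≡1+N+M))
      where
      a = f (suc i)
      b = f (suc (suc m) ∸ i)

    inner⇔ : ∀ {i} → i ≤ m →
             (g (suc i) + g (suc m ∸ i) ≤ M) ⇔ (N < f (suc i) + f (suc m ∸ i))
    inner⇔ {i} i≤m = subst (λ x → (g (suc i) + x ≤ M) ⇔ (N < a + b)) (sym (g-mirror i≤m))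
      (m+n≡1+o+p⇒m≤o⇔p<n (trans (+-comm ((K ∸ b) + (K ∸ a)) (a + b))
                                (trans (m+n+[o∸n+o∸m]≡o+o (f≤K (suc i)) (f≤K _)) K+K≡1+M+N)))
      where
      a = f (suc i)
      b = f (suc m ∸ i)

    reflect⇒ : Condᶠ N (suc m) f → Condᶠ M m g
    reflect⇒ C i 1≤i i≤m =
      Equivalence.to (outer⇔ i≤m) (≤-pred (proj₂ (C i 1≤i (m≤n⇒m≤1+n i≤m)))) ,
      s≤s (Equivalence.from (inner⇔ i≤m) (proj₁ (C (suc i) (s≤s z≤n) (s≤s i≤m))))

    reflect⇐ : Condᶠ M m g → Condᶠ N (suc m) f
    reflect⇐ G j 1≤j j≤1+m = lower j 1≤j j≤1+m , upper j 1≤j j≤1+m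
      where
      lower : ∀ j → 1 ≤ j → j ≤ suc m → N < f j + f (suc (suc m) ∸ j)
      lower (suc (suc i)) _ (s≤s 1+i≤m) =
        Equivalence.to (inner⇔ 1+i≤m) (≤-pred (proj₂ (G (suc i) (s≤s z≤n) 1+i≤m)))
      -- j = 1 is the case j = m + 1 read backwards, or K + K > N when m = 0.
      lower 1 _ _ with m≤n⇒m<n∨m≡n (z≤n {m})
      ... | inj₁ 1≤m =
        subst (N <_) swap (Equivalence.to (inner⇔ ≤-refl) (≤-pred (proj₂ (G m 1≤m ≤-refl))))
        where
        swap : f (suc m) + f (suc m ∸ m) ≡ f 1 + f (suc m)
        swap = trans (+-comm (f (suc m)) _) (cong (λ j → f j + f (suc m)) (m+n∸n≡m 1 m))
      ... | inj₂ refl = subst₂ (λ u v → N < u + v) (sym f-head) (sym f-head)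
                               (subst (N <_) (sym K+K≡1+N+M) (m≤m+n (suc N) M))
      upper : ∀ j → 1 ≤ j → j ≤ suc m → f (suc j) + f (suc (suc m) ∸ j) < suc N
      upper j 1≤j j≤1+m with m≤n⇒m<n∨m≡n j≤1+m
      ... | inj₁ (s≤s j≤m) = s≤s (Equivalence.from (outer⇔ j≤m) (proj₁ (G j 1≤j j≤m)))
      ... | inj₂ refl      = subst₂ (λ u v → u + v < suc N) (sym f-end) (sym f-last) (s≤s K≤N)

IsOC≤-∷⁻ : ∀ {N a β} → IsOC≤ N (a ∷ β) →
           ∃₂ λ k M → a ≡ suc (k * 2) × N ≡ Step.N k M × IsOC≤ M β
IsOC≤-∷⁻ {a = a} {β} (odd-a ∷ odds , Σ≤N)
  with k , refl ← Odd⇒∃[k]≡1+k*2 {a} odd-a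
  with d , refl ← m≤n⇒∃[o]m+o≡n Σ≤N
  = k , sum β + d , refl , +-assoc (suc (k * 2)) (sum β) d , odds , m≤m+n (sum β) d

P-bounds : ∀ {N} α → IsOC≤ N α → All (λ p → 0 < p × p ≤ N) (P N α)
P-bounds []      _   = []
P-bounds (a ∷ β) ocα with IsOC≤-∷⁻ ocα
... | k , M , refl , refl , ocβ = Step.P-∷-bounds k M ocβ (P-bounds β ocβ)

at-∷ : ∀ x xs {i} → 1 ≤ i → at (x ∷ xs) (suc i) ≡ at xs i
at-∷ x xs {suc i} _ = refl

at-∷-∸ : ∀ x xs {n i} → i ≤ n → at (x ∷ xs) (suc (suc n) ∸ i) ≡ at xs (suc n ∸ i)
at-∷-∸ x xs {n} {i} i≤n = begin
  at (x ∷ xs) (suc (suc n) ∸ i) ≡⟨ cong (at (x ∷ xs)) (+-∸-assoc 1 (m≤n⇒m≤1+n i≤n)) ⟩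
  at (x ∷ xs) (suc (suc n ∸ i)) ≡⟨ at-∷ x xs (m<n⇒0<n∸m (s≤s i≤n)) ⟩
  at xs (suc n ∸ i)             ∎

at-beyond : ∀ xs {i} → length xs < i → at xs i ≡ 0
at-beyond []       _                = refl
at-beyond (x ∷ xs) {suc (suc i)} (s≤s ℓ<1+i) = at-beyond xs ℓ<1+i

at-All : ∀ {P : ℕ → Set} {xs} → P 0 → All P xs → ∀ i → P (at xs i)
at-All p0 []         _             = p0
at-All p0 (px ∷ pxs) zero          = p0
at-All p0 (px ∷ pxs) (suc zero)    = px
at-All p0 (px ∷ pxs) (suc (suc i)) = at-All p0 pxs (suc i)

at-∷-≤ : ∀ {K rest} → All (_< K) rest → ∀ i → at (K ∷ rest) i ≤ K
at-∷-≤ rest<K = at-All z≤n (≤-refl ∷ All.map <⇒≤ rest<K)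

at-map : ∀ (f : ℕ → ℕ) xs {i} → 1 ≤ i → i ≤ length xs → at (map f xs) i ≡ f (at xs i)
at-map f (x ∷ xs) {suc zero}    _ _           = refl
at-map f (x ∷ xs) {suc (suc i)} _ (s≤s 1+i≤ℓ) = at-map f xs (s≤s z≤n) 1+i≤ℓ

at-∷ʳ : ∀ xs {x i} → i ≤ length xs → at (xs ∷ʳ x) i ≡ at xs i
at-∷ʳ []       z≤n               = refl
at-∷ʳ (y ∷ ys) {i = zero}        _           = refl
at-∷ʳ (y ∷ ys) {i = suc zero}    _           = refl
at-∷ʳ (y ∷ ys) {i = suc (suc i)} (s≤s 1+i≤ℓ) = at-∷ʳ ys 1+i≤ℓ

at-∷ʳ-last : ∀ xs {x} → at (xs ∷ʳ x) (suc (length xs)) ≡ x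
at-∷ʳ-last []       = refl
at-∷ʳ-last (y ∷ ys) = at-∷ʳ-last ys

≤-length-reverse : ∀ (xs : List ℕ) {i} → i ≤ length xs → i ≤ length (reverse xs)
≤-length-reverse xs {i} = subst (i ≤_) (sym (length-reverse xs))

at-reverse : ∀ xs {i} → i ≤ length xs → at (reverse xs) i ≡ at xs (suc (length xs) ∸ i)
at-reverse []       z≤n = refl
at-reverse (x ∷ xs) {i} i≤1+ℓ rewrite unfold-reverse x xs with m≤n⇒m<n∨m≡n i≤1+ℓ
... | inj₁ (s≤s i≤ℓ) = begin
  at (reverse xs ∷ʳ x) i                  ≡⟨ at-∷ʳ (reverse xs) (≤-length-reverse xs i≤ℓ) ⟩
  at (reverse xs) i                       ≡⟨ at-reverse xs i≤ℓ ⟩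
  at xs (suc (length xs) ∸ i)             ≡⟨ at-∷-∸ x xs i≤ℓ ⟨
  at (x ∷ xs) (suc (suc (length xs)) ∸ i) ∎
... | inj₂ refl = begin
  at (reverse xs ∷ʳ x) (suc (length xs))           ≡⟨ cong (at (reverse xs ∷ʳ x) ∘ suc) (length-reverse xs) ⟨
  at (reverse xs ∷ʳ x) (suc (length (reverse xs))) ≡⟨ at-∷ʳ-last (reverse xs) ⟩
  x                                                ≡⟨ cong (at (x ∷ xs)) (m+n∸n≡m 1 (length xs)) ⟨
  at (x ∷ xs) (suc (length xs) ∸ length xs)        ∎

reflect : ℕ → List ℕ → List ℕ
reflect K xs = map (K ∸_) (reverse xs)

length-reflect : ∀ K xs → length (reflect K xs) ≡ length xs
length-reflect K xs = trans (length-map (K ∸_) (reverse xs)) (length-reverse xs)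

at-reflect : ∀ K xs {i} → 1 ≤ i → i ≤ suc (length xs) →
             at (reflect K xs) i ≡ K ∸ at (K ∷ xs) (suc (suc (length xs)) ∸ i)
at-reflect K xs {i} 1≤i i≤1+ℓ with m≤n⇒m<n∨m≡n i≤1+ℓ
... | inj₁ (s≤s i≤ℓ) = begin
  at (map (K ∸_) (reverse xs)) i              ≡⟨ at-map (K ∸_) (reverse xs) 1≤i (≤-length-reverse xs i≤ℓ) ⟩
  K ∸ at (reverse xs) i                       ≡⟨ cong (K ∸_) (at-reverse xs i≤ℓ) ⟩
  K ∸ at xs (suc (length xs) ∸ i)             ≡⟨ cong (K ∸_) (at-∷-∸ K xs i≤ℓ) ⟨
  K ∸ at (K ∷ xs) (suc (suc (length xs)) ∸ i) ∎
... | inj₂ refl = begin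
  at (reflect K xs) (suc (length xs))           ≡⟨ at-beyond (reflect K xs) (s≤s (≤-reflexive ℓ-eq)) ⟩
  0                                             ≡⟨ n∸n≡0 K ⟨
  K ∸ at (K ∷ xs) 1                             ≡⟨ cong ((K ∸_) ∘ at (K ∷ xs)) (m+n∸n≡m 1 (length xs)) ⟨
  K ∸ at (K ∷ xs) (suc (length xs) ∸ length xs) ∎
  where
  ℓ-eq = length-reflect K xs

All-reverse : ∀ {P : ℕ → Set} {xs} → All P xs → All P (reverse xs)
All-reverse pxs = All.tabulate (All.lookup pxs ∘ Any.reverse⁻)

reflect-descending : ∀ {K xs} → AllPairs _>_ xs → All (_≤ K) xs → AllPairs _>_ (reflect K xs)
reflect-descending {K} {[]}     _              _            = []
reflect-descending {K} {x ∷ xs} (xs<x ∷ desc) (x≤K ∷ xs≤K)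
  rewrite unfold-reverse x xs | map-++ (K ∸_) (reverse xs) (x ∷ []) =
  AllPairs.++⁺ (reflect-descending desc xs≤K) ([] ∷ [])
               (All.map⁺ (All.map (λ y<x → ∸-monoʳ-< y<x x≤K ∷ []) (All-reverse xs<x)))

∈-reflect⁺ : ∀ {K x xs} → x ∈ xs → K ∸ x ∈ reflect K xs
∈-reflect⁺ {K} x∈xs = ∈-map⁺ (K ∸_) (Any.reverse⁺ x∈xs)

∈-reflect⁻ : ∀ {K y xs} → y ∈ reflect K xs → ∃ λ x → x ∈ xs × y ≡ K ∸ x
∈-reflect⁻ {K} y∈ with x , x∈ , refl ← ∈-map⁻ (K ∸_) y∈ = x , Any.reverse⁻ x∈ , refl

infix 4 _≐_
_≐_ : List ℕ → List ℕ → Set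
xs ≐ ys = ∀ y → (y ∈ xs) ⇔ (y ∈ ys)

≐-head : ∀ {x y xs ys} → All (_< x) xs → All (_< y) ys → x ∷ xs ≐ y ∷ ys → x ≡ y
≐-head {x} {y} xs<x ys<y E
  with Equivalence.from (E y) (here refl) | Equivalence.to (E x) (here refl)
... | here y≡x    | _           = sym y≡x
... | there _     | here x≡y    = x≡y
... | there y∈xs  | there x∈ys  =
  contradiction (All.lookup xs<x y∈xs) (<⇒≯ (All.lookup ys<y x∈ys))

∷-reflect-≐ : ∀ {K xs ys} → All (_< K) xs → All (λ q → 0 < q × q ≤ K) ys →
              (K ∷ xs ≐ K ∷ map (K ∸_) ys) ⇔ (reflect K xs ≐ ys)
∷-reflect-≐ {K} {xs} {ys} xs<K ys-bounds = mk⇔ cancel extend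
  where
  cancel : K ∷ xs ≐ K ∷ map (K ∸_) ys → reflect K xs ≐ ys
  cancel E y = mk⇔ to from
    where
    to : y ∈ reflect K xs → y ∈ ys
    to y∈ with x , x∈xs , refl ← ∈-reflect⁻ {xs = xs} y∈ with Equivalence.to (E x) (there x∈xs)
    ... | here x≡K = contradiction x≡K (<⇒≢ (All.lookup xs<K x∈xs))
    ... | there x∈ with q , q∈ys , refl ← ∈-map⁻ (K ∸_) x∈ =
      subst (_∈ ys) (sym (m∸[m∸n]≡n (proj₂ (All.lookup ys-bounds q∈ys)))) q∈ys
    from : y ∈ ys → y ∈ reflect K xs
    from y∈ys with (0<y , y≤K) ← All.lookup ys-bounds y∈ys
                 | Equivalence.from (E (K ∸ y)) (there (∈-map⁺ (K ∸_) y∈ys))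
    ... | here K∸y≡K    = contradiction K∸y≡K (<⇒≢ (∸-monoʳ-< 0<y y≤K))
    ... | there K∸y∈xs  = subst (_∈ reflect K xs) (m∸[m∸n]≡n y≤K) (∈-reflect⁺ K∸y∈xs)
  extend : reflect K xs ≐ ys → K ∷ xs ≐ K ∷ map (K ∸_) ys
  extend R y = mk⇔ to from
    where
    to : y ∈ K ∷ xs → y ∈ K ∷ map (K ∸_) ys
    to (here refl)  = here refl
    to (there y∈xs) =
      there (subst (_∈ map (K ∸_) ys) (m∸[m∸n]≡n (<⇒≤ (All.lookup xs<K y∈xs)))
                   (∈-map⁺ (K ∸_) (Equivalence.to (R (K ∸ y)) (∈-reflect⁺ y∈xs))))
    from : y ∈ K ∷ map (K ∸_) ys → y ∈ K ∷ xs
    from (here refl) = here refl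
    from (there y∈) with q , q∈ys , refl ← ∈-map⁻ (K ∸_) y∈
                    with x , x∈xs , refl ← ∈-reflect⁻ {xs = xs} (Equivalence.from (R q) q∈ys) =
      there (subst (_∈ xs) (sym (m∸[m∸n]≡n (<⇒≤ (All.lookup xs<K x∈xs)))) x∈xs)

module _ (k M : ℕ) where
  open Step k M

  Cond-∷⇔ : ∀ {rest} → All (_< K) rest → Cond N (K ∷ rest) ⇔ Cond M (reflect K rest)
  Cond-∷⇔ {rest} rest<K = mk⇔
    (λ C → subst (λ ℓ → Condᶠ M ℓ (at (reflect K rest))) (sym (length-reflect K rest))
                 (Condᶠ-cong (λ i 1≤i i≤ → sym (at-reflect K rest 1≤i i≤)) (reflect⇒ C)))
    (λ C → reflect⇐ (Condᶠ-cong (λ i → at-reflect K rest)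
                 (subst (λ ℓ → Condᶠ M ℓ (at (reflect K rest))) (length-reflect K rest) C)))
    where
    open Reflection (length rest) (at (K ∷ rest)) refl (at-beyond (K ∷ rest) ≤-refl)
                    (at-∷-≤ rest<K)

  P-bounds-K : ∀ {β} → IsOC≤ M β → All (λ q → 0 < q × q ≤ K) (P M β)
  P-bounds-K {β} ocβ = All.map (map₂ (λ q≤M → ≤-trans q≤M (<⇒≤ M<K))) (P-bounds β ocβ)

  ≐P-∷⇔ : ∀ {β rest} → IsOC≤ M β → All (_< K) rest →
          (K ∷ rest ≐ P N (suc (k * 2) ∷ β)) ⇔ (reflect K rest ≐ P M β)
  ≐P-∷⇔ {β} {rest} ocβ rest<K =
    subst (λ ys → (K ∷ rest ≐ ys) ⇔ (reflect K rest ≐ P M β)) (sym (P-∷ β (proj₂ ocβ)))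
          (∷-reflect-≐ rest<K (P-bounds-K ocβ))

  ≐P-head : ∀ {x rest β} → IsOC≤ M β → All (_< x) rest →
            x ∷ rest ≐ P N (suc (k * 2) ∷ β) → x ≡ K
  ≐P-head {x} {rest} {β} ocβ rest<x E =
    ≐-head rest<x (All.map⁺ (All.map (λ (0<q , q≤K) → ∸-monoʳ-< 0<q q≤K) (P-bounds-K ocβ)))
           (subst (x ∷ rest ≐_) (P-∷ β (proj₂ ocβ)) E)

Step-from-bounds : ∀ {K N} → K ≤ N → N < K + K →
                   ∃₂ λ k M → N ≡ Step.N k M × K ≡ Step.K k M
Step-from-bounds {K} K≤N N<K+K
  with k , refl ← m≤n⇒∃[o]m+o≡n K≤N
  with M , 1+N+M≡K+K ← m≤n⇒∃[o]m+o≡n N<K+K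
  = k , M , trans (cong (_+ k) K≡) (identity₂ k M) , K≡
  where
  identity₁ : ∀ K k M → K + suc (k + M) ≡ suc (K + k) + M
  identity₁ = solve-∀
  identity₂ : ∀ k M → suc (k + M) + k ≡ suc (k * 2 + M)
  identity₂ = solve-∀
  K≡ : K ≡ suc (k + M)
  K≡ = sym (+-cancelˡ-≡ K _ _ (trans (identity₁ K k M) 1+N+M≡K+K))

Step-from-Cond : ∀ {N K rest} → All (_< K) rest → Cond N (K ∷ rest) →
                 ∃₂ λ k M → N ≡ Step.N k M × K ≡ Step.K k M
Step-from-Cond {N} {K} {rest} rest<K C = Step-from-bounds K≤N N<K+K
  where
  ℓ = length rest
  K≤N : K ≤ N
  K≤N = ≤-pred (subst₂ (λ u v → u + v < suc N) (at-beyond (K ∷ rest) ≤-refl)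
                       (cong (at (K ∷ rest)) (m+n∸n≡m 1 ℓ)) (proj₂ (C (suc ℓ) (s≤s z≤n) ≤-refl)))
  N<K+K : N < K + K
  N<K+K = ≤-trans (proj₁ (C 1 (s≤s z≤n) (s≤s z≤n)))
                  (+-monoʳ-≤ K (at-∷-≤ rest<K (suc ℓ)))

Cond-[] : ∀ {N} → Cond N []
Cond-[] _ (s≤s _) ()

soundness : ∀ {N} α xs → IsOC≤ N α → AllPairs _>_ xs → xs ≐ P N α → Cond N xs
soundness _       []         _   _              _ = Cond-[]
soundness []      (x ∷ _)    _   _              E =
  contradiction (Equivalence.to (E x) (here refl)) λ ()
soundness (a ∷ β) (x ∷ rest) ocα (rest<x ∷ desc) E with IsOC≤-∷⁻ ocα
... | k , M , refl , refl , ocβ with refl ← ≐P-head k M ocβ rest<x E =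
  Equivalence.from (Cond-∷⇔ k M rest<x)
    (soundness β (reflect x rest) ocβ (reflect-descending desc (All.map <⇒≤ rest<x))
               (Equivalence.to (≐P-∷⇔ k M ocβ rest<x) E))

completeness : ∀ n {N} xs → length xs ≡ n → AllPairs _>_ xs → Cond N xs →
               ∃ λ α → IsOC≤ N α × xs ≐ P N α
completeness _       []         _   _               _ = [] , ([] , z≤n) , λ _ → mk⇔ id id
completeness zero    (_ ∷ _)    ()  _               _
completeness (suc n) (K ∷ rest) len (rest<K ∷ desc) C with Step-from-Cond rest<K C
... | k , M , refl , refl
  with β , ocβ , E ← completeness n (reflect K rest)
                       (trans (length-reflect K rest) (suc-injective len))
                       (reflect-descending desc (All.map <⇒≤ rest<K))
                       (Equivalence.to (Cond-∷⇔ k M rest<K) C)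
  = suc (k * 2) ∷ β , Step.IsOC≤-∷ k M ocβ , Equivalence.from (≐P-∷⇔ k M ocβ rest<K) E

proposition3p9 : (N : ℕ) → 0 < N → (xs : List ℕ) → xs ≢ [] → Linked _>_ xs → All (0 <_) xs →
    ((∃ λ α → IsOC≤ N α × (∀ y → (y ∈ xs) ⇔ (y ∈ P N α))) ⇔ Cond N xs)
proposition3p9 N _ xs _ linked _ =
  mk⇔ (λ (α , ocα , E) → soundness α xs ocα descending E)
      (completeness (length xs) xs refl descending)
  where
  descending : AllPairs _>_ xs
  descending = Linked⇒AllPairs (λ x>y y>z → <-trans y>z x>y) linked
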